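{- Let $n>0$. The lattice $\mathcal{D}_{n}^{B}=(D_n^B,\leq_D)$ of Dyck paths of type $B$ of semilength $n$ under dominance order is a Heyting algebra. The subset $D_n^A\subseteq D_n^B$ of Dyck paths of type $A$ of semilength $n$ forms a sublattice $\mathcal{D}_n^A$ of $\mathcal{D}_n^B$ which is itself a Heyting algebra, but $\mathcal{D}_n^A$ is not a Heyting subalgebra of $\mathcal{D}_n^B$. Conversely, $\mathcal{D}_n^B$ is a Heyting subalgebra of $\mathcal{D}_{2n}^A$, in the following sense: the map $\varphi:D_n^B\to D_{2n}^A$, $w\mapsto w\,\psi(w)$, is a lattice isomorphism from $\mathcal{D}_n^B$ onto the set of centrally symmetric Dyck words $\{v\in D_{2n}^A\mid \psi(v)=v\}$, and this set is a Heyting subalgebra of $\mathcal{D}_{2n}^A$.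
   Context: Dyck paths are identified with words over $\{u,r\}$ ($u$ an up-step $(0,1)$, $r$ a right-step $(1,0)$, path starting at $(0,0)$). $D_n^B$ is the set of words $w$ of length $2n$ over $\{u,r\}$ in which every prefix contains at least as many $u$'s as $r$'s; $D_n^A\subseteq D_n^B$ consists of those containing exactly $n$ letters $u$ (and $n$ letters $r$). Height sequence of $w\in D_n^B$: let $\rho$ be the number of $r$'s in $w$. If $w$ ends with $r$, put $k=\rho$ and let $h_i$ be the number of $u$'s preceding the $i$-th $r$; if $w$ ends with $u$, put $k=\rho+1$, let $h_i$ ($i\le\rho$) be the number of $u$'s preceding the $i$-th $r$, and let $h_k$ be the total number of $u$'s in $w$. Dominance order: $w\leq_D w'$ with height sequences $(h_1,\dots,h_k)$, $(h'_1,\dots,h'_{k'})$ iff $k\geq k'$ and $h_i\le h'_i$ for all $i\in[k']$. For $w\in D_n^A$ the height sequence is $(h_1,\dots,h_n)$ with $h_i$ the number of $u$'s before the $i$-th $r$, and on $D_n^A$ the dominance order is componentwise comparison. For a word $w$ over $\{u,r\}$, $\psi(w)$ is the word obtained by replacing every $u$ by $r$ and every $r$ by $u$ and then reversing the order of the letters. A lattice with $\hat0,\hat1$ is a Heyting algebra if for all $x,y$ there is a greatest $z$ (the relative pseudocomplement $x\to y$) with $x\wedge z\le y$. A Heyting subalgebra is a subset containing $\hat0$ and $\hat1$ and closed under $\wedge$, $\vee$ and $\to$ (computed in the ambient algebra). -}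

module Defs where

open import Data.Nat using (ℕ; zero; suc; _+_; _*_; _≤_)
open import Data.List using (List; []; _∷_; _++_; length; map; reverse; [_])
open import Data.Product using (Σ; _×_; _,_; ∃)
open import Relation.Binary.PropositionalEquality using (_≡_)
open import Function.Bundles using (_⇔_)

data Letter : Set where
  u r : Letter

Word : Set
Word = List Letter

#u : Word → ℕ
#u []       = 0
#u (u ∷ w)  = suc (#u w)
#u (r ∷ w)  = #u w

#r : Word → ℕ
#r []       = 0
#r (u ∷ w)  = #r w
#r (r ∷ w)  = suc (#r w)

PrefixCondition : Word → Set
PrefixCondition w = ∀ (p s : Word) → w ≡ p ++ s → #r p ≤ #u p

DB : ℕ → Word → Set
DB n w = (length w ≡ 2 * n) × PrefixCondition w

DA : ℕ → Word → Set
DA n w = DB n w × (#u w ≡ n)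

rheights : ℕ → Word → List ℕ
rheights c []       = []
rheights c (u ∷ w)  = rheights (suc c) w
rheights c (r ∷ w)  = c ∷ rheights c w

-- last letter of a word (r for the empty word, whose height sequence is empty)
lastLetter : Word → Letter
lastLetter []            = r
lastLetter (a ∷ [])      = a
lastLetter (a ∷ b ∷ w)   = lastLetter (b ∷ w)

heights : Word → List ℕ
heights w with lastLetter w
... | u = rheights 0 w ++ [ #u w ]
... | r = rheights 0 w

data _≼_ : List ℕ → List ℕ → Set where
  []≼  : ∀ {xs} → xs ≼ []
  _∷≼_ : ∀ {x y xs ys} → x ≤ y → xs ≼ ys → (x ∷ xs) ≼ (y ∷ ys)

_≤D_ : Word → Word → Set
w ≤D w' = heights w ≼ heights w'

swap : Letter → Letter
swap u = r
swap r = u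

ψ : Word → Word
ψ w = reverse (map swap w)

φ : Word → Word
φ w = w ++ ψ w

Sym : ℕ → Word → Set
Sym m v = DA m v × (ψ v ≡ v)

module _ (S : Word → Set) (_≤_ : Word → Word → Set) where

  IsPartialOrderOn : Set
  IsPartialOrderOn =
    (∀ x → S x → x ≤ x) ×
    (∀ x y z → S x → S y → S z → x ≤ y → y ≤ z → x ≤ z) ×
    (∀ x y → S x → S y → x ≤ y → y ≤ x → x ≡ y)

  IsBottomIn : Word → Set
  IsBottomIn z = S z × (∀ w → S w → z ≤ w)

  IsTopIn : Word → Set
  IsTopIn z = S z × (∀ w → S w → w ≤ z)

  IsMeetIn : Word → Word → Word → Set
  IsMeetIn x y z = S z × z ≤ x × z ≤ y ×
    (∀ w → S w → w ≤ x → w ≤ y → w ≤ z)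

  IsJoinIn : Word → Word → Word → Set
  IsJoinIn x y z = S z × x ≤ z × y ≤ z ×
    (∀ w → S w → x ≤ w → y ≤ w → z ≤ w)

  MeetBelow : Word → Word → Word → Set
  MeetBelow x z y = ∀ m → IsMeetIn x z m → m ≤ y

  IsImpIn : Word → Word → Word → Set
  IsImpIn x y z = S z × MeetBelow x z y ×
    (∀ w → S w → MeetBelow x w y → w ≤ z)

  IsLatticeOn : Set
  IsLatticeOn = IsPartialOrderOn ×
    (∀ x y → S x → S y → ∃ λ z → IsMeetIn x y z) ×
    (∀ x y → S x → S y → ∃ λ z → IsJoinIn x y z)

  IsHeytingAlgebraOn : Set
  IsHeytingAlgebraOn = IsLatticeOn ×
    (∃ λ z → IsBottomIn z) ×
    (∃ λ z → IsTopIn z) ×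
    (∀ x y → S x → S y → ∃ λ z → IsImpIn x y z)

IsSublatticeOf : (T S : Word → Set) (_≤_ : Word → Word → Set) → Set
IsSublatticeOf T S _≤_ =
  (∀ x → T x → S x) ×
  (∀ x y z → T x → T y → IsMeetIn S _≤_ x y z → T z) ×
  (∀ x y z → T x → T y → IsJoinIn S _≤_ x y z → T z)

IsHeytingSubalgebraOf : (T S : Word → Set) (_≤_ : Word → Word → Set) → Set
IsHeytingSubalgebraOf T S _≤_ =
  IsSublatticeOf T S _≤_ ×
  (∀ z → IsBottomIn S _≤_ z → T z) ×
  (∀ z → IsTopIn S _≤_ z → T z) ×
  (∀ x y z → T x → T y → IsImpIn S _≤_ x y z → T z)

-- On words of equal length, dominance says that one lattice path never rises above the other: each
-- prefix of the lower word has at most as many u's (the height sequence lists the heights of the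
-- r-steps once the path is closed by one step against its last letter). Meet and join are then the
-- pointwise minimum and maximum of these prefix counts, so the words of a given length form a
-- distributive lattice, of which D_n^B = [(ur)^n, u^(2n)] and D_n^A = [(ur)^n, u^n r^n] are intervals:
-- finite distributive lattices, hence Heyting algebras, x → y being the join of all z with x ∧ z ≤ y.
-- Meets and joins of type-A paths computed in D_n^B are of type A, but the top u^(2n) of D_n^B is not.
-- The half-turn ψ preserves the comparison of two paths while swapping the initial and final gap between
-- them, so on D_(2n)^A, where all paths end at the same height, it is an involutive order automorphism;
-- the fixed points of such an automorphism form a Heyting subalgebra, by uniqueness of meets, joins,
-- bounds and implications. The same gap argument makes φ(w) = w ψ(w) monotone, and a symmetric word is
-- φ of its first half.

module Submission where

open import Defs
open import Data.Nat using (ℕ; zero; suc; _+_; _*_; _∸_; _≤_; _<_; z≤n; s≤s; s≤s⁻¹; _⊓_; _⊔_)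
open import Data.Nat.Properties
open import Data.List using (List; []; _∷_; _++_; _∷ʳ_; [_]; length; map; reverse; replicate; foldr; filter; take; drop; initLast; _∷ʳ′_)
open import Data.List.Properties using (map-∘; map-cong; map-id; ∷-injectiveˡ; ∷-injectiveʳ; length-++; unfold-reverse; reverse-++; reverse-map; reverse-involutive; length-reverse; length-map; map-++; take++drop≡id; length-take; length-drop; length-replicate)
open import Data.List.Membership.Propositional using (_∈_)
open import Data.List.Relation.Unary.Any using (here; there)
open import Data.List.Membership.Propositional.Properties using (∈-++⁺ˡ; ∈-++⁺ʳ; ∈-map⁺; ∈-filter⁺)
open import Data.List.Relation.Unary.All as All using (All; []; _∷_)
open import Data.List.Relation.Unary.All.Properties using (all-filter)
open import Data.Product using (_×_; _,_; ∃; proj₁; proj₂; map₂)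
open import Data.Sum as Sum using (_⊎_; inj₁; inj₂)
open import Data.Empty using (⊥)
open import Data.Unit using (⊤; tt)
open import Relation.Binary.PropositionalEquality using (_≡_; refl; sym; trans; cong; cong₂; subst; subst₂; module ≡-Reasoning)
open import Relation.Nullary using (¬_; Dec; yes; no; contradiction; _×-dec_)
open import Function.Bundles using (_⇔_; mk⇔)

module Unique (S : Word → Set) (_≤_ : Word → Word → Set)
              (antisym : ∀ {x y} → S x → S y → x ≤ y → y ≤ x → x ≡ y) where

  meet-unique : ∀ {x y z z′} → IsMeetIn S _≤_ x y z → IsMeetIn S _≤_ x y z′ → z ≡ z′
  meet-unique (sz , zx , zy , gz) (sz′ , z′x , z′y , gz′) = antisym sz sz′ (gz′ _ sz zx zy) (gz _ sz′ z′x z′y)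

  join-unique : ∀ {x y z z′} → IsJoinIn S _≤_ x y z → IsJoinIn S _≤_ x y z′ → z ≡ z′
  join-unique (sz , xz , yz , lz) (sz′ , xz′ , yz′ , lz′) = antisym sz sz′ (lz _ sz′ xz′ yz′) (lz′ _ sz xz yz)

  bottom-unique : ∀ {z z′} → IsBottomIn S _≤_ z → IsBottomIn S _≤_ z′ → z ≡ z′
  bottom-unique (sz , bz) (sz′ , bz′) = antisym sz sz′ (bz _ sz′) (bz′ _ sz)

  top-unique : ∀ {z z′} → IsTopIn S _≤_ z → IsTopIn S _≤_ z′ → z ≡ z′
  top-unique (sz , tz) (sz′ , tz′) = antisym sz sz′ (tz′ _ sz) (tz _ sz′)

  imp-unique : ∀ {x y z z′} → IsImpIn S _≤_ x y z → IsImpIn S _≤_ x y z′ → z ≡ z′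
  imp-unique (sz , mz , gz) (sz′ , mz′ , gz′) = antisym sz sz′ (gz′ _ sz mz) (gz _ sz′ mz′)

  sublattice : ∀ {T} → (∀ {x} → T x → S x) →
    (∀ {x y} → T x → T y → ∃ λ z → T z × IsMeetIn S _≤_ x y z) →
    (∀ {x y} → T x → T y → ∃ λ z → T z × IsJoinIn S _≤_ x y z) →
    IsSublatticeOf T S _≤_
  sublattice T⊆S meetT joinT =
    (λ _ → T⊆S) ,
    (λ x y z tx ty m → let (z′ , tz′ , m′) = meetT tx ty in subst _ (meet-unique m′ m) tz′) ,
    (λ x y z tx ty j → let (z′ , tz′ , j′) = joinT tx ty in subst _ (join-unique j′ j) tz′)

-- An involutive automorphism carries each meet, join, bound and implication to one of its image,
-- so by uniqueness those built from fixed points are fixed.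
module Involution (S : Word → Set) (_≤_ : Word → Word → Set) (f : Word → Word)
                  (f-S : ∀ {x} → S x → S (f x)) (f-involutive : ∀ x → f (f x) ≡ x)
                  (f-mono : ∀ {x y} → S x → S y → x ≤ y → f x ≤ f y)
                  (antisym : ∀ {x y} → S x → S y → x ≤ y → y ≤ x → x ≡ y) where

  open Unique S _≤_ antisym

  Fixed : Word → Set
  Fixed x = S x × f x ≡ x

  f-adjointˡ : ∀ {x y} → S x → S y → f x ≤ y → x ≤ f y
  f-adjointˡ {x} {y} sx sy h = subst (_≤ f y) (f-involutive x) (f-mono (f-S sx) sy h)

  f-adjointʳ : ∀ {x y} → S x → S y → x ≤ f y → f x ≤ y
  f-adjointʳ {x} {y} sx sy h = subst (f x ≤_) (f-involutive y) (f-mono sx (f-S sy) h)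

  f-meet : ∀ {x y z} → S x → S y → IsMeetIn S _≤_ x y z → IsMeetIn S _≤_ (f x) (f y) (f z)
  f-meet sx sy (sz , zx , zy , gz) = f-S sz , f-mono sz sx zx , f-mono sz sy zy ,
    λ w sw wx wy → f-adjointˡ sw sz (gz (f w) (f-S sw) (f-adjointʳ sw sx wx) (f-adjointʳ sw sy wy))

  f-join : ∀ {x y z} → S x → S y → IsJoinIn S _≤_ x y z → IsJoinIn S _≤_ (f x) (f y) (f z)
  f-join sx sy (sz , xz , yz , lz) = f-S sz , f-mono sx sz xz , f-mono sy sz yz ,
    λ w sw xw yw → f-adjointʳ sz sw (lz (f w) (f-S sw) (f-adjointˡ sx sw xw) (f-adjointˡ sy sw yw))

  f-bottom : ∀ {z} → IsBottomIn S _≤_ z → IsBottomIn S _≤_ (f z)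
  f-bottom (sz , bz) = f-S sz , λ w sw → f-adjointʳ sz sw (bz (f w) (f-S sw))

  f-top : ∀ {z} → IsTopIn S _≤_ z → IsTopIn S _≤_ (f z)
  f-top (sz , tz) = f-S sz , λ w sw → f-adjointˡ sw sz (tz (f w) (f-S sw))

  f-meetBelow : ∀ {x w y} → S x → S w → S y → MeetBelow S _≤_ x w y → MeetBelow S _≤_ (f x) (f w) (f y)
  f-meetBelow {x} {w} sx sw sy below m isMeet = f-adjointˡ (proj₁ isMeet) sy (below (f m)
    (subst₂ (λ a b → IsMeetIn S _≤_ a b (f m)) (f-involutive x) (f-involutive w) (f-meet (f-S sx) (f-S sw) isMeet)))

  f-imp : ∀ {x y z} → S x → S y → IsImpIn S _≤_ x y z → IsImpIn S _≤_ (f x) (f y) (f z)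
  f-imp {x} {y} sx sy (sz , below , gz) = f-S sz , f-meetBelow sx sz sy below ,
    λ w sw below′ → f-adjointˡ sw sz (gz (f w) (f-S sw)
      (subst₂ (λ a b → MeetBelow S _≤_ a (f w) b) (f-involutive x) (f-involutive y)
        (f-meetBelow (f-S sx) sw (f-S sy) below′)))

  fixed-heytingSubalgebra : IsHeytingSubalgebraOf Fixed S _≤_
  fixed-heytingSubalgebra =
    ((λ _ → proj₁) ,
     (λ x y z (sx , fx) (sy , fy) m → proj₁ m ,
        meet-unique (subst₂ (λ a b → IsMeetIn S _≤_ a b (f z)) fx fy (f-meet sx sy m)) m) ,
     (λ x y z (sx , fx) (sy , fy) j → proj₁ j ,
        join-unique (subst₂ (λ a b → IsJoinIn S _≤_ a b (f z)) fx fy (f-join sx sy j)) j)) ,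
    (λ z b → proj₁ b , bottom-unique (f-bottom b) b) ,
    (λ z t → proj₁ t , top-unique (f-top t) t) ,
    (λ x y z (sx , fx) (sy , fy) i → proj₁ i ,
       imp-unique (subst₂ (λ a b → IsImpIn S _≤_ a b (f z)) fx fy (f-imp sx sy i)) i)

-- Below k x y: starting k units higher, the path y stays weakly above the path x.
data Below : ℕ → Word → Word → Set where
  done : ∀ {k} → Below k [] []
  uu   : ∀ {k x y} → Below k x y → Below k (u ∷ x) (u ∷ y)
  rr   : ∀ {k x y} → Below k x y → Below k (r ∷ x) (r ∷ y)
  ru   : ∀ {k x y} → Below (suc k) x y → Below k (r ∷ x) (u ∷ y)
  ur   : ∀ {k x y} → Below k x y → Below (suc k) (u ∷ x) (r ∷ y)

infix 4 _⊑_
_⊑_ : Word → Word → Set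
x ⊑ y = Below 0 x y

Below-length : ∀ {k x y} → Below k x y → length x ≡ length y
Below-length done   = refl
Below-length (uu h) = cong suc (Below-length h)
Below-length (rr h) = cong suc (Below-length h)
Below-length (ru h) = cong suc (Below-length h)
Below-length (ur h) = cong suc (Below-length h)

Below-refl : ∀ {k} x → Below k x x
Below-refl []      = done
Below-refl (u ∷ x) = uu (Below-refl x)
Below-refl (r ∷ x) = rr (Below-refl x)

⊑-antisym : ∀ {x y} → x ⊑ y → y ⊑ x → x ≡ y
⊑-antisym done   done    = refl
⊑-antisym (uu h) (uu h′) = cong (u ∷_) (⊑-antisym h h′)
⊑-antisym (rr h) (rr h′) = cong (r ∷_) (⊑-antisym h h′)
⊑-antisym (ru h) ()

Below-prefix : ∀ {k} x y {s t} → length x ≡ length y → Below k (x ++ s) (y ++ t) → Below k x y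
Below-prefix []      []      _ _      = done
Below-prefix (a ∷ x) (b ∷ y) e (uu h) = uu (Below-prefix x y (suc-injective e) h)
Below-prefix (a ∷ x) (b ∷ y) e (rr h) = rr (Below-prefix x y (suc-injective e) h)
Below-prefix (a ∷ x) (b ∷ y) e (ru h) = ru (Below-prefix x y (suc-injective e) h)
Below-prefix (a ∷ x) (b ∷ y) e (ur h) = ur (Below-prefix x y (suc-injective e) h)

Below-#u : ∀ {k x y} → Below k x y → #u x ≤ k + #u y
Below-#u done = z≤n
Below-#u {k} (uu h) = ≤-trans (s≤s (Below-#u h)) (≤-reflexive (sym (+-suc k _)))
Below-#u (rr h) = Below-#u h
Below-#u {k} (ru h) = ≤-trans (Below-#u h) (≤-reflexive (sym (+-suc k _)))
Below-#u (ur h) = s≤s (Below-#u h)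

Below-u^ : ∀ k x → Below k x (replicate (length x) u)
Below-u^ k []      = done
Below-u^ k (u ∷ x) = uu (Below-u^ k x)
Below-u^ k (r ∷ x) = ru (Below-u^ (suc k) x)

Below? : ∀ k x y → Dec (Below k x y)
Below? k []      []      = yes done
Below? k []      (_ ∷ _) = no λ ()
Below? k (_ ∷ _) []      = no λ ()
Below? k (u ∷ x) (u ∷ y) with Below? k x y
... | yes h = yes (uu h)
... | no ¬h = no λ { (uu h) → ¬h h }
Below? k (r ∷ x) (r ∷ y) with Below? k x y
... | yes h = yes (rr h)
... | no ¬h = no λ { (rr h) → ¬h h }
Below? k (r ∷ x) (u ∷ y) with Below? (suc k) x y
... | yes h = yes (ru h)
... | no ¬h = no λ { (ru h) → ¬h h }
Below? zero    (u ∷ x) (r ∷ y) = no λ ()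
Below? (suc k) (u ∷ x) (r ∷ y) with Below? k x y
... | yes h = yes (ur h)
... | no ¬h = no λ { (ur h) → ¬h h }

Below⇒≤-prefix : ∀ {k x y} → Below k x y → ∀ j → #u (take j x) ≤ k + #u (take j y)
Below⇒≤-prefix h      zero    = z≤n
Below⇒≤-prefix done   (suc j) = z≤n
Below⇒≤-prefix {k} (uu h) (suc j) = ≤-trans (s≤s (Below⇒≤-prefix h j)) (≤-reflexive (sym (+-suc k _)))
Below⇒≤-prefix (rr h) (suc j) = Below⇒≤-prefix h j
Below⇒≤-prefix {k} (ru h) (suc j) = ≤-trans (Below⇒≤-prefix h j) (≤-reflexive (sym (+-suc k _)))
Below⇒≤-prefix (ur h) (suc j) = s≤s (Below⇒≤-prefix h j)

≤-prefix⇒Below : ∀ k x y → length x ≡ length y → (∀ j → #u (take j x) ≤ k + #u (take j y)) → Below k x y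
≤-prefix⇒Below k [] [] _ _ = done
≤-prefix⇒Below k (u ∷ x) (u ∷ y) e le =
  uu (≤-prefix⇒Below k x y (suc-injective e) λ j → s≤s⁻¹ (≤-trans (le (suc j)) (≤-reflexive (+-suc k _))))
≤-prefix⇒Below k (r ∷ x) (r ∷ y) e le = rr (≤-prefix⇒Below k x y (suc-injective e) λ j → le (suc j))
≤-prefix⇒Below k (r ∷ x) (u ∷ y) e le =
  ru (≤-prefix⇒Below (suc k) x y (suc-injective e) λ j → ≤-trans (le (suc j)) (≤-reflexive (+-suc k _)))
≤-prefix⇒Below zero (u ∷ x) (r ∷ y) e le with le 1
... | ()
≤-prefix⇒Below (suc k) (u ∷ x) (r ∷ y) e le = ur (≤-prefix⇒Below k x y (suc-injective e) λ j → s≤s⁻¹ (le (suc j)))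

≤-prefix⇒⊑ : ∀ {x y} → length x ≡ length y → (∀ j → #u (take j x) ≤ #u (take j y)) → x ⊑ y
≤-prefix⇒⊑ = ≤-prefix⇒Below 0 _ _

⊑-trans : ∀ {x y z} → x ⊑ y → y ⊑ z → x ⊑ z
⊑-trans h h′ = ≤-prefix⇒⊑ (trans (Below-length h) (Below-length h′)) λ j → ≤-trans (Below⇒≤-prefix h j) (Below⇒≤-prefix h′ j)

climb : Letter → ℕ → ℕ
climb u c = suc c
climb r c = c

height : ℕ → Word → ℕ → ℕ
height c w       zero    = c
height c []      (suc j) = c
height c (a ∷ w) (suc j) = height (climb a c) w j

height≡+#u-take : ∀ c w j → height c w j ≡ c + #u (take j w)
height≡+#u-take c w       zero    = sym (+-identityʳ c)
height≡+#u-take c []      (suc j) = sym (+-identityʳ c)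
height≡+#u-take c (u ∷ w) (suc j) = trans (height≡+#u-take (suc c) w j) (sym (+-suc c _))
height≡+#u-take c (r ∷ w) (suc j) = height≡+#u-take c w j

OneStep : ℕ → ℕ → Set
OneStep p q = p ≡ q ⊎ p ≡ suc q

suc-⊓-step : ∀ c d → OneStep (suc c ⊓ d) (c ⊓ d)
suc-⊓-step zero    zero    = inj₁ refl
suc-⊓-step zero    (suc d) = inj₂ refl
suc-⊓-step (suc c) zero    = inj₁ refl
suc-⊓-step (suc c) (suc d) = Sum.map (cong suc) (cong suc) (suc-⊓-step c d)

suc-⊔-step : ∀ c d → OneStep (suc c ⊔ d) (c ⊔ d)
suc-⊔-step zero    zero    = inj₂ refl
suc-⊔-step zero    (suc d) = inj₁ refl
suc-⊔-step (suc c) zero    = inj₂ refl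
suc-⊔-step (suc c) (suc d) = Sum.map (cong suc) (cong suc) (suc-⊔-step c d)

letterTo : ℕ → ℕ → Letter
letterTo p q with p ≟ q
... | yes _ = r
... | no _  = u

climb-letterTo : ∀ {p q} → OneStep p q → climb (letterTo p q) q ≡ p
climb-letterTo {p} {q} step with p ≟ q | step
... | yes p≡q | _          = sym p≡q
... | no p≢q  | inj₁ p≡q   = contradiction p≡q p≢q
... | no _    | inj₂ p≡1+q = sym p≡1+q

-- The heights of merge c d x y are the pointwise ∙ of those of x and y; this needs ∙ to move by at
-- most one step when one argument does.
module Merge (_∙_ : ℕ → ℕ → ℕ) (∙-comm : ∀ c d → c ∙ d ≡ d ∙ c) (0∙0 : 0 ∙ 0 ≡ 0)
             (suc-∙-suc : ∀ c d → suc c ∙ suc d ≡ suc (c ∙ d))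
             (suc-∙-step : ∀ c d → OneStep (suc c ∙ d) (c ∙ d)) where

  climb-∙-step : ∀ a b c d → OneStep (climb a c ∙ climb b d) (c ∙ d)
  climb-∙-step u u c d = inj₂ (suc-∙-suc c d)
  climb-∙-step r r c d = inj₁ refl
  climb-∙-step u r c d = suc-∙-step c d
  climb-∙-step r u c d = subst₂ OneStep (∙-comm (suc d) c) (∙-comm d c) (suc-∙-step d c)

  merge : ℕ → ℕ → Word → Word → Word
  merge c d (a ∷ x) (b ∷ y) = letterTo (climb a c ∙ climb b d) (c ∙ d) ∷ merge (climb a c) (climb b d) x y
  merge c d _       _       = []

  length-merge : ∀ c d x y → length x ≡ length y → length (merge c d x y) ≡ length x
  length-merge c d []      []      _ = refl
  length-merge c d (a ∷ x) (b ∷ y) e = cong suc (length-merge _ _ x y (suc-injective e))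

  height-merge : ∀ c d x y j → length x ≡ length y →
                 height (c ∙ d) (merge c d x y) j ≡ height c x j ∙ height d y j
  height-merge c d x       y       zero    _ = refl
  height-merge c d []      []      (suc j) _ = refl
  height-merge c d (a ∷ x) (b ∷ y) (suc j) e =
    trans (cong (λ h → height h (merge (climb a c) (climb b d) x y) j) (climb-letterTo (climb-∙-step a b c d)))
          (height-merge (climb a c) (climb b d) x y j (suc-injective e))

  merged : Word → Word → Word
  merged = merge 0 0

  #u-take-merged : ∀ x y j → length x ≡ length y → #u (take j (merged x y)) ≡ #u (take j x) ∙ #u (take j y)
  #u-take-merged x y j e = begin
    #u (take j (merged x y))      ≡⟨ height≡+#u-take 0 (merged x y) j ⟨
    height 0 (merged x y) j       ≡⟨ cong (λ c → height c (merged x y) j) 0∙0 ⟨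
    height (0 ∙ 0) (merged x y) j ≡⟨ height-merge 0 0 x y j e ⟩
    height 0 x j ∙ height 0 y j   ≡⟨ cong₂ _∙_ (height≡+#u-take 0 x j) (height≡+#u-take 0 y j) ⟩
    #u (take j x) ∙ #u (take j y) ∎
    where open ≡-Reasoning

module Meet = Merge _⊓_ ⊓-comm refl (λ _ _ → refl) suc-⊓-step
module Join = Merge _⊔_ ⊔-comm refl (λ _ _ → refl) suc-⊔-step

infixr 7 _∧_
infixr 6 _∨_

_∧_ _∨_ : Word → Word → Word
_∧_ = Meet.merged
_∨_ = Join.merged

length-∧ : ∀ x y → length x ≡ length y → length (x ∧ y) ≡ length x
length-∧ = Meet.length-merge 0 0

length-∨ : ∀ x y → length x ≡ length y → length (x ∨ y) ≡ length x
length-∨ = Join.length-merge 0 0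

∧-lowerˡ : ∀ {x y} → length x ≡ length y → x ∧ y ⊑ x
∧-lowerˡ {x} {y} e = ≤-prefix⇒⊑ (length-∧ x y e) λ j →
  ≤-trans (≤-reflexive (Meet.#u-take-merged x y j e)) (m⊓n≤m _ _)

∧-lowerʳ : ∀ {x y} → length x ≡ length y → x ∧ y ⊑ y
∧-lowerʳ {x} {y} e = ≤-prefix⇒⊑ (trans (length-∧ x y e) e) λ j →
  ≤-trans (≤-reflexive (Meet.#u-take-merged x y j e)) (m⊓n≤n _ _)

∧-greatest : ∀ {w x y} → w ⊑ x → w ⊑ y → w ⊑ x ∧ y
∧-greatest {w} {x} {y} h h′ = ≤-prefix⇒⊑ (trans (Below-length h) (sym (length-∧ x y e))) λ j →
  ≤-trans (⊓-glb (Below⇒≤-prefix h j) (Below⇒≤-prefix h′ j)) (≤-reflexive (sym (Meet.#u-take-merged x y j e)))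
  where e = trans (sym (Below-length h)) (Below-length h′)

∨-upperˡ : ∀ {x y} → length x ≡ length y → x ⊑ x ∨ y
∨-upperˡ {x} {y} e = ≤-prefix⇒⊑ (sym (length-∨ x y e)) λ j →
  ≤-trans (m≤m⊔n _ _) (≤-reflexive (sym (Join.#u-take-merged x y j e)))

∨-upperʳ : ∀ {x y} → length x ≡ length y → y ⊑ x ∨ y
∨-upperʳ {x} {y} e = ≤-prefix⇒⊑ (sym (trans (length-∨ x y e) e)) λ j →
  ≤-trans (m≤n⊔m _ _) (≤-reflexive (sym (Join.#u-take-merged x y j e)))

∨-least : ∀ {w x y} → x ⊑ w → y ⊑ w → x ∨ y ⊑ w
∨-least {w} {x} {y} h h′ = ≤-prefix⇒⊑ (trans (length-∨ x y e) (Below-length h)) λ j →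
  ≤-trans (≤-reflexive (Join.#u-take-merged x y j e)) (⊔-lub (Below⇒≤-prefix h j) (Below⇒≤-prefix h′ j))
  where e = trans (Below-length h) (sym (Below-length h′))

∧-distribˡ-∨ : ∀ {x a b} → length x ≡ length a → length a ≡ length b → x ∧ (a ∨ b) ⊑ (x ∧ a) ∨ (x ∧ b)
∧-distribˡ-∨ {x} {a} {b} xa ab = ≤-prefix⇒⊑ (trans (length-∧ x _ x-ab) (sym (trans (length-∨ (x ∧ a) (x ∧ b) xa-xb) (length-∧ x a xa)))) λ j →
  ≤-reflexive (begin
    #u (take j (x ∧ (a ∨ b)))                   ≡⟨ Meet.#u-take-merged x (a ∨ b) j x-ab ⟩
    #u (take j x) ⊓ #u (take j (a ∨ b))         ≡⟨ cong (#u (take j x) ⊓_) (Join.#u-take-merged a b j ab) ⟩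
    #u (take j x) ⊓ (#u (take j a) ⊔ #u (take j b)) ≡⟨ ⊓-distribˡ-⊔ _ _ _ ⟩
    (#u (take j x) ⊓ #u (take j a)) ⊔ (#u (take j x) ⊓ #u (take j b))
      ≡⟨ cong₂ _⊔_ (Meet.#u-take-merged x a j xa) (Meet.#u-take-merged x b j xb) ⟨
    #u (take j (x ∧ a)) ⊔ #u (take j (x ∧ b))   ≡⟨ Join.#u-take-merged (x ∧ a) (x ∧ b) j xa-xb ⟨
    #u (take j ((x ∧ a) ∨ (x ∧ b)))             ∎)
  where
  open ≡-Reasoning
  xb : length x ≡ length b
  xb = trans xa ab
  x-ab : length x ≡ length (a ∨ b)
  x-ab = trans xa (sym (length-∨ a b ab))
  xa-xb : length (x ∧ a) ≡ length (x ∧ b)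
  xa-xb = trans (length-∧ x a xa) (sym (length-∧ x b xb))

-- BelowTo k l x y: as Below k x y, with y ending exactly l units above x.
data BelowTo : ℕ → ℕ → Word → Word → Set where
  done : ∀ {k} → BelowTo k k [] []
  uu   : ∀ {k l x y} → BelowTo k l x y → BelowTo k l (u ∷ x) (u ∷ y)
  rr   : ∀ {k l x y} → BelowTo k l x y → BelowTo k l (r ∷ x) (r ∷ y)
  ru   : ∀ {k l x y} → BelowTo (suc k) l x y → BelowTo k l (r ∷ x) (u ∷ y)
  ur   : ∀ {k l x y} → BelowTo k l x y → BelowTo (suc k) l (u ∷ x) (r ∷ y)

BelowTo⇒Below : ∀ {k l x y} → BelowTo k l x y → Below k x y
BelowTo⇒Below done   = done
BelowTo⇒Below (uu h) = uu (BelowTo⇒Below h)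
BelowTo⇒Below (rr h) = rr (BelowTo⇒Below h)
BelowTo⇒Below (ru h) = ru (BelowTo⇒Below h)
BelowTo⇒Below (ur h) = ur (BelowTo⇒Below h)

Below⇒BelowTo : ∀ {k x y} → Below k x y → ∃ λ l → BelowTo k l x y
Below⇒BelowTo {k} done = k , done
Below⇒BelowTo (uu h) = map₂ uu (Below⇒BelowTo h)
Below⇒BelowTo (rr h) = map₂ rr (Below⇒BelowTo h)
Below⇒BelowTo (ru h) = map₂ ru (Below⇒BelowTo h)
Below⇒BelowTo (ur h) = map₂ ur (Below⇒BelowTo h)

BelowTo-#u : ∀ {k l x y} → BelowTo k l x y → k + #u y ≡ l + #u x
BelowTo-#u done = refl
BelowTo-#u {k} {l} (uu h) = trans (+-suc k _) (trans (cong suc (BelowTo-#u h)) (sym (+-suc l _)))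
BelowTo-#u (rr h) = BelowTo-#u h
BelowTo-#u {k} (ru h) = trans (+-suc k _) (BelowTo-#u h)
BelowTo-#u {l = l} (ur h) = trans (cong suc (BelowTo-#u h)) (sym (+-suc l _))

BelowTo-++ : ∀ {k l m x y x′ y′} → BelowTo k l x y → BelowTo l m x′ y′ → BelowTo k m (x ++ x′) (y ++ y′)
BelowTo-++ done   g = g
BelowTo-++ (uu h) g = uu (BelowTo-++ h g)
BelowTo-++ (rr h) g = rr (BelowTo-++ h g)
BelowTo-++ (ru h) g = ru (BelowTo-++ h g)
BelowTo-++ (ur h) g = ur (BelowTo-++ h g)

BelowTo-∷ʳ : ∀ {k l x y} a → BelowTo k l x y → BelowTo k l (x ∷ʳ a) (y ∷ʳ a)
BelowTo-∷ʳ u h = BelowTo-++ h (uu done)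
BelowTo-∷ʳ r h = BelowTo-++ h (rr done)

BelowTo-∷ʳ-ru : ∀ {k l x y} → BelowTo k l x y → BelowTo k (suc l) (x ∷ʳ r) (y ∷ʳ u)
BelowTo-∷ʳ-ru h = BelowTo-++ h (ru done)

BelowTo-∷ʳ-ur : ∀ {k l x y} → BelowTo k (suc l) x y → BelowTo k l (x ∷ʳ u) (y ∷ʳ r)
BelowTo-∷ʳ-ur h = BelowTo-++ h (ur done)

data FirstR : Word → Set where
  all-u : ∀ m → FirstR (replicate m u)
  at    : ∀ m t → FirstR (replicate m u ++ r ∷ t)

firstR : ∀ w → FirstR w
firstR []      = all-u 0
firstR (r ∷ t) = at 0 t
firstR (u ∷ w) with firstR w
... | all-u m = all-u (suc m)
... | at m t  = at (suc m) t

rheights-u^ : ∀ m c → rheights c (replicate m u) ≡ []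
rheights-u^ zero    c = refl
rheights-u^ (suc m) c = rheights-u^ m (suc c)

rheights-first-r : ∀ m c t →
  rheights (suc c) (replicate m u ++ r ∷ t) ≡ (m + suc c) ∷ rheights c (replicate m u ++ u ∷ t)
rheights-first-r zero    c t = refl
rheights-first-r (suc m) c t = trans (rheights-first-r m (suc c) t) (cong (_∷ rheights (suc c) (replicate m u ++ u ∷ t)) (+-suc m (suc c)))

rheights-≼-∷⇒≤ : ∀ {d c x ys} → rheights d x ≼ (c ∷ ys) → d ≤ c
rheights-≼-∷⇒≤ {x = u ∷ x} h          = ≤-trans (n≤1+n _) (rheights-≼-∷⇒≤ {x = x} h)
rheights-≼-∷⇒≤ {x = r ∷ x} (d≤c ∷≼ _) = d≤c

-- Turning the first r of y into u lifts the rest of y by one unit, which is worth one unit of head start.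
trade-r-for-u : ∀ m {k x t} → Below (suc k) x (replicate m u ++ r ∷ t) → Below k x (replicate m u ++ u ∷ t)
trade-r-for-u zero    (rr h) = ru h
trade-r-for-u zero    (ur h) = uu h
trade-r-for-u (suc m) (uu h) = uu (trade-r-for-u m h)
trade-r-for-u (suc m) (ru h) = ru (trade-r-for-u m h)

trade-u-for-r : ∀ m {k x t} → Below k x (replicate m u ++ u ∷ t) → Below (suc k) x (replicate m u ++ r ∷ t)
trade-u-for-r zero    (uu h) = ur h
trade-u-for-r zero    (ru h) = rr h
trade-u-for-r (suc m) (uu h) = uu (trade-u-for-r m h)
trade-u-for-r (suc m) (ru h) = ru (trade-u-for-r m h)

⊑⇒rheights-≼ : ∀ c {x y} → x ⊑ y → rheights c x ≼ rheights c y
⊑⇒rheights-≼ c done   = []≼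
⊑⇒rheights-≼ c (uu h) = ⊑⇒rheights-≼ (suc c) h
⊑⇒rheights-≼ c (rr h) = ≤-refl ∷≼ ⊑⇒rheights-≼ c h
⊑⇒rheights-≼ c (ru {y = y} h) with firstR y
... | all-u m = subst (_ ≼_) (sym (rheights-u^ m (suc c))) []≼
... | at m t  = subst (_ ≼_) (sym (rheights-first-r m c t))
                  (≤-trans (n≤1+n c) (m≤n+m (suc c) m) ∷≼ ⊑⇒rheights-≼ c (trade-r-for-u m h))

rheights-≼⇒⊑ : ∀ c {x y} → length x ≡ length y → rheights c x ≼ rheights c y → x ⊑ y
rheights-≼⇒⊑ c {[]}    {[]}    _ _ = done
rheights-≼⇒⊑ c {u ∷ x} {u ∷ y} e h = uu (rheights-≼⇒⊑ (suc c) (suc-injective e) h)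
rheights-≼⇒⊑ c {r ∷ x} {r ∷ y} e (_ ∷≼ h) = rr (rheights-≼⇒⊑ c (suc-injective e) h)
rheights-≼⇒⊑ c {u ∷ x} {r ∷ y} e h = contradiction (rheights-≼-∷⇒≤ {x = x} h) 1+n≰n
rheights-≼⇒⊑ c {r ∷ x} {u ∷ y} e h with firstR y
... | all-u m = ru (subst (Below 1 x) (cong (λ n → replicate n u) (trans (suc-injective e) (length-replicate m)))
                          (Below-u^ 1 x))
... | at m t with subst (_ ≼_) (rheights-first-r m c t) h
...   | _ ∷≼ h′ = ru (trade-u-for-r m (rheights-≼⇒⊑ c x≡ h′))
  where
  x≡ : length x ≡ length (replicate m u ++ u ∷ t)
  x≡ = trans (suc-injective e) (trans (length-++ (replicate m u)) (sym (length-++ (replicate m u))))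

pad : Word → Word
pad w = w ∷ʳ swap (lastLetter w)

lastLetter-∷ʳ : ∀ p a → lastLetter (p ∷ʳ a) ≡ a
lastLetter-∷ʳ []          a = refl
lastLetter-∷ʳ (b ∷ [])    a = refl
lastLetter-∷ʳ (b ∷ c ∷ p) a = lastLetter-∷ʳ (c ∷ p) a

length-∷ʳ : ∀ p (a : Letter) → length (p ∷ʳ a) ≡ suc (length p)
length-∷ʳ p a = trans (length-++ p) (+-comm (length p) 1)

length-pad : ∀ w → length (pad w) ≡ suc (length w)
length-pad w = length-∷ʳ w _

rheights-∷ʳ-r : ∀ c w → rheights c (w ∷ʳ r) ≡ rheights c w ∷ʳ (#u w + c)
rheights-∷ʳ-r c []      = refl
rheights-∷ʳ-r c (u ∷ w) = trans (rheights-∷ʳ-r (suc c) w) (cong (λ h → rheights (suc c) w ∷ʳ h) (+-suc (#u w) c))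
rheights-∷ʳ-r c (r ∷ w) = cong (c ∷_) (rheights-∷ʳ-r c w)

rheights-∷ʳ-u : ∀ c w → rheights c (w ∷ʳ u) ≡ rheights c w
rheights-∷ʳ-u c []      = refl
rheights-∷ʳ-u c (u ∷ w) = rheights-∷ʳ-u (suc c) w
rheights-∷ʳ-u c (r ∷ w) = cong (c ∷_) (rheights-∷ʳ-u c w)

-- Closing a path by one step against its last letter turns its height sequence into the plain list
-- of heights of its r-steps.
heights≡rheights-pad : ∀ w → heights w ≡ rheights 0 (pad w)
heights≡rheights-pad w with lastLetter w
... | u = sym (trans (rheights-∷ʳ-r 0 w) (cong (λ h → rheights 0 w ∷ʳ h) (+-identityʳ (#u w))))
... | r = sym (rheights-∷ʳ-u 0 w)

pad-∷ʳ : ∀ p a → pad (p ∷ʳ a) ≡ p ∷ʳ a ∷ʳ swap a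
pad-∷ʳ p a = cong (λ b → p ∷ʳ a ∷ʳ swap b) (lastLetter-∷ʳ p a)

pad-mono-∷ʳ : ∀ a b {p q} → length p ≡ length q → p ∷ʳ a ⊑ q ∷ʳ b → p ∷ʳ a ∷ʳ swap a ⊑ q ∷ʳ b ∷ʳ swap b
pad-mono-∷ʳ u u _ h = BelowTo⇒Below (BelowTo-∷ʳ r (proj₂ (Below⇒BelowTo h)))
pad-mono-∷ʳ r r _ h = BelowTo⇒Below (BelowTo-∷ʳ u (proj₂ (Below⇒BelowTo h)))
pad-mono-∷ʳ u r _ h = BelowTo⇒Below (BelowTo-∷ʳ-ru (proj₂ (Below⇒BelowTo h)))
pad-mono-∷ʳ r u {p} {q} e h =
  BelowTo⇒Below (BelowTo-∷ʳ-ur (BelowTo-∷ʳ-ru (proj₂ (Below⇒BelowTo (Below-prefix p q e h)))))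

pad-mono : ∀ {x y} → length x ≡ length y → x ⊑ y → pad x ⊑ pad y
pad-mono {x} {y} e h with initLast x | initLast y
... | []      | []      = Below-refl _
... | []      | q ∷ʳ′ b = contradiction (trans e (length-∷ʳ q b)) λ ()
... | p ∷ʳ′ a | []      = contradiction (trans (sym (length-∷ʳ p a)) e) λ ()
... | p ∷ʳ′ a | q ∷ʳ′ b = subst₂ _⊑_ (sym (pad-∷ʳ p a)) (sym (pad-∷ʳ q b))
  (pad-mono-∷ʳ a b (suc-injective (trans (sym (length-∷ʳ p a)) (trans e (length-∷ʳ q b)))) h)

⊑⇒≤D : ∀ {x y} → length x ≡ length y → x ⊑ y → x ≤D y
⊑⇒≤D {x} {y} e h = subst₂ _≼_ (sym (heights≡rheights-pad x)) (sym (heights≡rheights-pad y))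
  (⊑⇒rheights-≼ 0 (pad-mono e h))

≤D⇒⊑ : ∀ {x y} → length x ≡ length y → x ≤D y → x ⊑ y
≤D⇒⊑ {x} {y} e h = Below-prefix x y e (rheights-≼⇒⊑ 0 pad-length
  (subst₂ _≼_ (heights≡rheights-pad x) (heights≡rheights-pad y) h))
  where
  pad-length : length (pad x) ≡ length (pad y)
  pad-length = trans (length-pad x) (trans (cong suc e) (sym (length-pad y)))

zigzag : ℕ → Word
zigzag zero    = []
zigzag (suc n) = u ∷ r ∷ zigzag n

peak : ℕ → Word
peak n = replicate n u ++ replicate n r

length-zigzag : ∀ n → length (zigzag n) ≡ 2 * n
length-zigzag zero    = refl
length-zigzag (suc n) = trans (cong (λ m → suc (suc m)) (length-zigzag n)) (sym (*-distribˡ-+ 2 1 n))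

#u-zigzag : ∀ n → #u (zigzag n) ≡ n
#u-zigzag zero    = refl
#u-zigzag (suc n) = cong suc (#u-zigzag n)

zigzag-+ : ∀ m n → zigzag (m + n) ≡ zigzag m ++ zigzag n
zigzag-+ zero    n = refl
zigzag-+ (suc m) n = cong (λ w → u ∷ r ∷ w) (zigzag-+ m n)

2*n≡n+n : ∀ n → 2 * n ≡ n + n
2*n≡n+n n = cong (n +_) (+-identityʳ n)

twice : ℕ → ℕ
twice zero    = zero
twice (suc d) = suc (suc (twice d))

Ballot : ℕ → Word → Set
Ballot k       []      = ⊤
Ballot k       (u ∷ w) = Ballot (suc k) w
Ballot zero    (r ∷ w) = ⊥
Ballot (suc k) (r ∷ w) = Ballot k w

PrefixBallot : ℕ → Word → Set
PrefixBallot k w = ∀ (p s : Word) → w ≡ p ++ s → #r p ≤ k + #u p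

Ballot⇒PrefixBallot : ∀ k w → Ballot k w → PrefixBallot k w
Ballot⇒PrefixBallot k       w       b []      s eq = z≤n
Ballot⇒PrefixBallot k       (u ∷ w) b (u ∷ p) s eq =
  ≤-trans (Ballot⇒PrefixBallot (suc k) w b p s (∷-injectiveʳ eq)) (≤-reflexive (sym (+-suc k (#u p))))
Ballot⇒PrefixBallot (suc k) (r ∷ w) b (r ∷ p) s eq = s≤s (Ballot⇒PrefixBallot k w b p s (∷-injectiveʳ eq))

PrefixBallot⇒Ballot : ∀ k w → PrefixBallot k w → Ballot k w
PrefixBallot⇒Ballot k       []      pb = tt
PrefixBallot⇒Ballot k       (u ∷ w) pb = PrefixBallot⇒Ballot (suc k) w λ p s eq →
  ≤-trans (pb (u ∷ p) s (cong (u ∷_) eq)) (≤-reflexive (+-suc k (#u p)))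
PrefixBallot⇒Ballot zero    (r ∷ w) pb with pb (r ∷ []) w refl
... | ()
PrefixBallot⇒Ballot (suc k) (r ∷ w) pb = PrefixBallot⇒Ballot k w λ p s eq → s≤s⁻¹ (pb (r ∷ p) s (cong (r ∷_) eq))

-- Above the zigzag, being at height 2d (resp. 2d+1) is a head start of d over zigzag (resp. r ∷ zigzag).
mutual
  Ballot⇒zigzag-Below : ∀ d m w → Ballot (twice d) w → length w ≡ length (zigzag m) → Below d (zigzag m) w
  Ballot⇒zigzag-Below d       zero    []      _ _ = done
  Ballot⇒zigzag-Below d       (suc m) (u ∷ w) b e = uu (Ballot⇒r-zigzag-Below d m w b (suc-injective e))
  Ballot⇒zigzag-Below (suc d) (suc m) (r ∷ w) b e = ur (Ballot⇒r-zigzag-Below d m w b (suc-injective e))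

  Ballot⇒r-zigzag-Below : ∀ d m w → Ballot (suc (twice d)) w → length w ≡ suc (length (zigzag m)) →
                          Below d (r ∷ zigzag m) w
  Ballot⇒r-zigzag-Below d m (u ∷ w) b e = ru (Ballot⇒zigzag-Below (suc d) m w b (suc-injective e))
  Ballot⇒r-zigzag-Below d m (r ∷ w) b e = rr (Ballot⇒zigzag-Below d m w b (suc-injective e))

mutual
  zigzag-Below⇒Ballot : ∀ {d m w} → Below d (zigzag m) w → Ballot (twice d) w
  zigzag-Below⇒Ballot {m = zero}  done   = tt
  zigzag-Below⇒Ballot {m = suc m} (uu h) = r-zigzag-Below⇒Ballot h
  zigzag-Below⇒Ballot {m = suc m} (ur h) = r-zigzag-Below⇒Ballot h

  r-zigzag-Below⇒Ballot : ∀ {d m w} → Below d (r ∷ zigzag m) w → Ballot (suc (twice d)) w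
  r-zigzag-Below⇒Ballot (rr h) = zigzag-Below⇒Ballot h
  r-zigzag-Below⇒Ballot (ru h) = zigzag-Below⇒Ballot h

DB⇒zigzag-⊑ : ∀ {n w} → DB n w → zigzag n ⊑ w
DB⇒zigzag-⊑ {n} {w} (len , pc) =
  Ballot⇒zigzag-Below 0 n w (PrefixBallot⇒Ballot 0 w pc) (trans len (sym (length-zigzag n)))

zigzag-⊑⇒DB : ∀ {n w} → zigzag n ⊑ w → DB n w
zigzag-⊑⇒DB {n} {w} h = trans (sym (Below-length h)) (length-zigzag n) , Ballot⇒PrefixBallot 0 w (zigzag-Below⇒Ballot h)

DB⇒⊑-u^ : ∀ {n w} → DB n w → w ⊑ replicate (2 * n) u
DB⇒⊑-u^ {w = w} (len , _) = subst (λ m → w ⊑ replicate m u) len (Below-u^ 0 w)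

#u-replicate-u : ∀ m → #u (replicate m u) ≡ m
#u-replicate-u zero    = refl
#u-replicate-u (suc m) = cong suc (#u-replicate-u m)

#u-replicate-r : ∀ m → #u (replicate m r) ≡ 0
#u-replicate-r zero    = refl
#u-replicate-r (suc m) = #u-replicate-r m

#u-++ : ∀ x y → #u (x ++ y) ≡ #u x + #u y
#u-++ []      y = refl
#u-++ (u ∷ x) y = cong suc (#u-++ x y)
#u-++ (r ∷ x) y = #u-++ x y

#u-peak : ∀ n → #u (peak n) ≡ n
#u-peak n = trans (#u-++ (replicate n u) _) (trans (cong₂ _+_ (#u-replicate-u n) (#u-replicate-r n)) (+-identityʳ n))

Below-r^ : ∀ k m w → length w ≡ m → #u w ≤ k → Below k w (replicate m r)
Below-r^ k       zero    []      _ _  = done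
Below-r^ (suc k) (suc m) (u ∷ w) e le = ur (Below-r^ k m w (suc-injective e) (s≤s⁻¹ le))
Below-r^ k       (suc m) (r ∷ w) e le = rr (Below-r^ k m w (suc-injective e) le)

Below-u^r^ : ∀ k m p w → length w ≡ m + p → #u w ≤ k + m → Below k w (replicate m u ++ replicate p r)
Below-u^r^ k zero    p w       e le = Below-r^ k p w e (≤-trans le (≤-reflexive (+-identityʳ k)))
Below-u^r^ k (suc m) p (u ∷ w) e le =
  uu (Below-u^r^ k m p w (suc-injective e) (s≤s⁻¹ (≤-trans le (≤-reflexive (+-suc k m)))))
Below-u^r^ k (suc m) p (r ∷ w) e le =
  ru (Below-u^r^ (suc k) m p w (suc-injective e) (≤-trans le (≤-reflexive (+-suc k m))))

DA⇒zigzag-⊑-peak : ∀ {n w} → DA n w → zigzag n ⊑ w × w ⊑ peak n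
DA⇒zigzag-⊑-peak {n} {w} (db , #u≡n) =
  DB⇒zigzag-⊑ db , Below-u^r^ 0 n n w (trans (proj₁ db) (2*n≡n+n n)) (≤-reflexive #u≡n)

zigzag-⊑-peak⇒DA : ∀ {n w} → zigzag n ⊑ w → w ⊑ peak n → DA n w
zigzag-⊑-peak⇒DA {n} {w} h h′ = zigzag-⊑⇒DB h ,
  ≤-antisym (≤-trans (Below-#u h′) (≤-reflexive (#u-peak n))) (≤-trans (≤-reflexive (sym (#u-zigzag n))) (Below-#u h))

words : ℕ → List Word
words zero    = [] ∷ []
words (suc L) = map (u ∷_) (words L) ++ map (r ∷_) (words L)

∈-words : ∀ w → w ∈ words (length w)
∈-words []      = here refl
∈-words (u ∷ w) = ∈-++⁺ˡ (∈-map⁺ (u ∷_) (∈-words w))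
∈-words (r ∷ w) = ∈-++⁺ʳ (map (u ∷_) (words (length w))) (∈-map⁺ (r ∷_) (∈-words w))

module Interval (lo hi : Word) (lo⊑hi : lo ⊑ hi) (S : Word → Set)
                (interval⇒S : ∀ {w} → lo ⊑ w → w ⊑ hi → S w)
                (S⇒interval : ∀ {w} → S w → lo ⊑ w × w ⊑ hi) where

  length-S : ∀ {w} → S w → length w ≡ length lo
  length-S s = sym (Below-length (proj₁ (S⇒interval s)))

  length-S₂ : ∀ {x y} → S x → S y → length x ≡ length y
  length-S₂ sx sy = trans (length-S sx) (sym (length-S sy))

  S-≤D⇒⊑ : ∀ {x y} → S x → S y → x ≤D y → x ⊑ y
  S-≤D⇒⊑ sx sy = ≤D⇒⊑ (length-S₂ sx sy)

  S-⊑⇒≤D : ∀ {x y} → S x → S y → x ⊑ y → x ≤D y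
  S-⊑⇒≤D sx sy = ⊑⇒≤D (length-S₂ sx sy)

  antisym : ∀ {x y} → S x → S y → x ≤D y → y ≤D x → x ≡ y
  antisym sx sy h h′ = ⊑-antisym (S-≤D⇒⊑ sx sy h) (S-≤D⇒⊑ sy sx h′)

  isPartialOrder : IsPartialOrderOn S _≤D_
  isPartialOrder =
    (λ x sx → S-⊑⇒≤D sx sx (Below-refl x)) ,
    (λ x y z sx sy sz h h′ → S-⊑⇒≤D sx sz (⊑-trans (S-≤D⇒⊑ sx sy h) (S-≤D⇒⊑ sy sz h′))) ,
    (λ x y sx sy → antisym sx sy)

  ∧-S : ∀ {x y} → S x → S y → S (x ∧ y)
  ∧-S sx sy = interval⇒S (∧-greatest (proj₁ (S⇒interval sx)) (proj₁ (S⇒interval sy)))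
                         (⊑-trans (∧-lowerˡ (length-S₂ sx sy)) (proj₂ (S⇒interval sx)))

  ∨-S : ∀ {x y} → S x → S y → S (x ∨ y)
  ∨-S sx sy = interval⇒S (⊑-trans (proj₁ (S⇒interval sx)) (∨-upperˡ (length-S₂ sx sy)))
                         (∨-least (proj₂ (S⇒interval sx)) (proj₂ (S⇒interval sy)))

  ∧-isMeet : ∀ {x y} → S x → S y → IsMeetIn S _≤D_ x y (x ∧ y)
  ∧-isMeet sx sy = let s∧ = ∧-S sx sy in
    s∧ , S-⊑⇒≤D s∧ sx (∧-lowerˡ (length-S₂ sx sy)) , S-⊑⇒≤D s∧ sy (∧-lowerʳ (length-S₂ sx sy)) ,
    λ w sw h h′ → S-⊑⇒≤D sw s∧ (∧-greatest (S-≤D⇒⊑ sw sx h) (S-≤D⇒⊑ sw sy h′))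

  ∨-isJoin : ∀ {x y} → S x → S y → IsJoinIn S _≤D_ x y (x ∨ y)
  ∨-isJoin sx sy = let s∨ = ∨-S sx sy in
    s∨ , S-⊑⇒≤D sx s∨ (∨-upperˡ (length-S₂ sx sy)) , S-⊑⇒≤D sy s∨ (∨-upperʳ (length-S₂ sx sy)) ,
    λ w sw h h′ → S-⊑⇒≤D s∨ sw (∨-least (S-≤D⇒⊑ sx sw h) (S-≤D⇒⊑ sy sw h′))

  lo-S : S lo
  lo-S = interval⇒S (Below-refl lo) lo⊑hi

  hi-S : S hi
  hi-S = interval⇒S lo⊑hi (Below-refl hi)

  lo-isBottom : IsBottomIn S _≤D_ lo
  lo-isBottom = lo-S , λ w sw → S-⊑⇒≤D lo-S sw (proj₁ (S⇒interval sw))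

  hi-isTop : IsTopIn S _≤D_ hi
  hi-isTop = hi-S , λ w sw → S-⊑⇒≤D sw hi-S (proj₂ (S⇒interval sw))

  ⋁ : List Word → Word
  ⋁ = foldr _∨_ lo

  ⋁-S : ∀ {zs} → All S zs → S (⋁ zs)
  ⋁-S []         = lo-S
  ⋁-S (sz ∷ szs) = ∨-S sz (⋁-S szs)

  ⋁-upper : ∀ {z zs} → All S zs → z ∈ zs → z ⊑ ⋁ zs
  ⋁-upper (sz ∷ szs) (here refl) = ∨-upperˡ (length-S₂ sz (⋁-S szs))
  ⋁-upper (sz ∷ szs) (there z∈)  = ⊑-trans (⋁-upper szs z∈) (∨-upperʳ (length-S₂ sz (⋁-S szs)))

  module Implication {x y} (sx : S x) (sy : S y) where

    Candidate : Word → Set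
    Candidate z = (lo ⊑ z × z ⊑ hi) × x ∧ z ⊑ y

    candidate? : ∀ z → Dec (Candidate z)
    candidate? z = (Below? 0 lo z ×-dec Below? 0 z hi) ×-dec Below? 0 (x ∧ z) y

    candidate-S : ∀ {z} → Candidate z → S z
    candidate-S ((h , h′) , _) = interval⇒S h h′

    ⋁-meet : ∀ {zs} → All Candidate zs → x ∧ ⋁ zs ⊑ y
    ⋁-meet [] = ⊑-trans (∧-lowerʳ (length-S sx)) (proj₁ (S⇒interval sy))
    ⋁-meet {z ∷ zs} (cz ∷ czs) =
      ⊑-trans (∧-distribˡ-∨ (length-S₂ sx sz) (length-S₂ sz (⋁-S (All.map candidate-S czs))))
              (∨-least (proj₂ cz) (⋁-meet czs))
      where sz = candidate-S cz

    candidates : List Word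
    candidates = filter candidate? (words (length lo))

    all-candidates : All Candidate candidates
    all-candidates = all-filter candidate? (words (length lo))

    imp : Word
    imp = ⋁ candidates

    imp-S : S imp
    imp-S = ⋁-S (All.map candidate-S all-candidates)

    isImp : IsImpIn S _≤D_ x y imp
    isImp = imp-S ,
      (λ m (sm , m≤x , m≤imp , _) → S-⊑⇒≤D sm sy
        (⊑-trans (∧-greatest (S-≤D⇒⊑ sm sx m≤x) (S-≤D⇒⊑ sm imp-S m≤imp)) (⋁-meet all-candidates))) ,
      λ w sw below → S-⊑⇒≤D sw imp-S
        (⋁-upper (All.map candidate-S all-candidates)
          (∈-filter⁺ candidate? (subst (λ L → w ∈ words L) (length-S sw) (∈-words w))
            (S⇒interval sw , S-≤D⇒⊑ (∧-S sx sw) sy (below (x ∧ w) (∧-isMeet sx sw)))))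

  isHeytingAlgebra : IsHeytingAlgebraOn S _≤D_
  isHeytingAlgebra =
    (isPartialOrder , (λ x y sx sy → x ∧ y , ∧-isMeet sx sy) , (λ x y sx sy → x ∨ y , ∨-isJoin sx sy)) ,
    (lo , lo-isBottom) , (hi , hi-isTop) , λ x y sx sy → Implication.imp sx sy , Implication.isImp sx sy

zigzag-⊑-u^ : ∀ n → zigzag n ⊑ replicate (2 * n) u
zigzag-⊑-u^ n = DB⇒⊑-u^ {n} (zigzag-⊑⇒DB (Below-refl (zigzag n)))

zigzag-⊑-peak : ∀ n → zigzag n ⊑ peak n
zigzag-⊑-peak n = proj₂ (DA⇒zigzag-⊑-peak (zigzag-⊑⇒DB (Below-refl (zigzag n)) , #u-zigzag n))

module TypeB (n : ℕ) = Interval (zigzag n) (replicate (2 * n) u) (zigzag-⊑-u^ n) (DB n)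
  (λ h _ → zigzag-⊑⇒DB h) (λ d → DB⇒zigzag-⊑ d , DB⇒⊑-u^ {n} d)

module TypeA (n : ℕ) = Interval (zigzag n) (peak n) (zigzag-⊑-peak n) (DA n)
  zigzag-⊑-peak⇒DA DA⇒zigzag-⊑-peak

u^-not-DA : ∀ {n} → 0 < n → ¬ DA n (replicate (2 * n) u)
u^-not-DA {n} n>0 (_ , #u≡n) = <⇒≢ n>0 (sym (+-cancelˡ-≡ n n 0 n+n≡n+0))
  where
  n+n≡n+0 : n + n ≡ n + 0
  n+n≡n+0 = trans (sym (2*n≡n+n n)) (trans (sym (#u-replicate-u (2 * n))) (trans #u≡n (sym (+-identityʳ n))))

ψ-∷ : ∀ a w → ψ (a ∷ w) ≡ ψ w ∷ʳ swap a
ψ-∷ a w = unfold-reverse (swap a) (map swap w)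

swap-involutive : ∀ a → swap (swap a) ≡ a
swap-involutive u = refl
swap-involutive r = refl

ψ-involutive : ∀ w → ψ (ψ w) ≡ w
ψ-involutive w = begin
  reverse (map swap (reverse (map swap w)))  ≡⟨ cong reverse (reverse-map swap (map swap w)) ⟩
  reverse (reverse (map swap (map swap w)))  ≡⟨ reverse-involutive _ ⟩
  map swap (map swap w)                      ≡⟨ map-∘ w ⟨
  map (λ a → swap (swap a)) w                ≡⟨ map-cong swap-involutive w ⟩
  map (λ a → a) w                            ≡⟨ map-id w ⟩
  w                                          ∎
  where open ≡-Reasoning

ψ-++ : ∀ x y → ψ (x ++ y) ≡ ψ y ++ ψ x
ψ-++ x y = trans (cong reverse (map-++ swap x y)) (reverse-++ (map swap x) (map swap y))

length-ψ : ∀ w → length (ψ w) ≡ length w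
length-ψ w = trans (length-reverse (map swap w)) (length-map swap w)

#u-ψ : ∀ w → #u (ψ w) ≡ #r w
#u-ψ []      = refl
#u-ψ (u ∷ w) = trans (cong #u (ψ-∷ u w)) (trans (#u-++ (ψ w) [ r ]) (trans (+-identityʳ _) (#u-ψ w)))
#u-ψ (r ∷ w) = trans (cong #u (ψ-∷ r w)) (trans (#u-++ (ψ w) [ u ]) (trans (+-comm _ 1) (cong suc (#u-ψ w))))

#u+#r≡length : ∀ w → #u w + #r w ≡ length w
#u+#r≡length []      = refl
#u+#r≡length (u ∷ w) = cong suc (#u+#r≡length w)
#u+#r≡length (r ∷ w) = trans (+-suc (#u w) (#r w)) (cong suc (#u+#r≡length w))

ψ-zigzag : ∀ n → ψ (zigzag n) ≡ zigzag n
ψ-zigzag zero    = refl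
ψ-zigzag (suc n) = begin
  ψ (zigzag 1 ++ zigzag n)    ≡⟨ ψ-++ (zigzag 1) (zigzag n) ⟩
  ψ (zigzag n) ++ zigzag 1    ≡⟨ cong (_++ zigzag 1) (ψ-zigzag n) ⟩
  zigzag n ++ zigzag 1        ≡⟨ zigzag-+ n 1 ⟨
  zigzag (n + 1)              ≡⟨ cong zigzag (+-comm n 1) ⟩
  zigzag (suc n)              ∎
  where open ≡-Reasoning

-- ψ reverses a path through its centre, so the head start y has at the end becomes its head start at the beginning.
ψ-BelowTo : ∀ {k l x y} → BelowTo k l x y → BelowTo l k (ψ x) (ψ y)
ψ-BelowTo done = done
ψ-BelowTo {x = u ∷ x} {u ∷ y} (uu h) = subst₂ (BelowTo _ _) (sym (ψ-∷ u x)) (sym (ψ-∷ u y)) (BelowTo-∷ʳ r (ψ-BelowTo h))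
ψ-BelowTo {x = r ∷ x} {r ∷ y} (rr h) = subst₂ (BelowTo _ _) (sym (ψ-∷ r x)) (sym (ψ-∷ r y)) (BelowTo-∷ʳ u (ψ-BelowTo h))
ψ-BelowTo {x = r ∷ x} {u ∷ y} (ru h) = subst₂ (BelowTo _ _) (sym (ψ-∷ r x)) (sym (ψ-∷ u y)) (BelowTo-∷ʳ-ur (ψ-BelowTo h))
ψ-BelowTo {x = u ∷ x} {r ∷ y} (ur h) = subst₂ (BelowTo _ _) (sym (ψ-∷ u x)) (sym (ψ-∷ r y)) (BelowTo-∷ʳ-ru (ψ-BelowTo h))

ψ-mono : ∀ {x y} → x ⊑ y → #u x ≡ #u y → ψ x ⊑ ψ y
ψ-mono {x} {y} h #u≡ with Below⇒BelowTo h
... | l , g = BelowTo⇒Below (subst (λ k → BelowTo k 0 (ψ x) (ψ y)) l≡0 (ψ-BelowTo g))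
  where
  l≡0 : l ≡ 0
  l≡0 = +-cancelʳ-≡ (#u x) l 0 (trans (sym (BelowTo-#u g)) (sym #u≡))

ψ-DA : ∀ {m v} → DA m v → DA m (ψ v)
ψ-DA {m} {v} (db@(len , _) , #u≡m) = zigzag-⊑⇒DB zigzag⊑ψv , trans (#u-ψ v) #r≡m
  where
  zigzag⊑ψv : zigzag m ⊑ ψ v
  zigzag⊑ψv = subst (_⊑ ψ v) (ψ-zigzag m) (ψ-mono (DB⇒zigzag-⊑ {m} db) (trans (#u-zigzag m) (sym #u≡m)))
  #r≡m : #r v ≡ m
  #r≡m = +-cancelˡ-≡ m (#r v) m (trans (cong (_+ #r v) (sym #u≡m)) (trans (#u+#r≡length v) (trans len (2*n≡n+n m))))

ψ-≤D-mono : ∀ m {x y} → DA m x → DA m y → x ≤D y → ψ x ≤D ψ y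
ψ-≤D-mono m dx dy h = TypeA.S-⊑⇒≤D m (ψ-DA dx) (ψ-DA dy)
  (ψ-mono (TypeA.S-≤D⇒⊑ m dx dy h) (trans (proj₂ dx) (sym (proj₂ dy))))

module SymmetricA (m : ℕ) = Involution (DA m) _≤D_ ψ ψ-DA ψ-involutive (ψ-≤D-mono m) (TypeA.antisym m)

++-cancel-prefix : ∀ (x y : Word) {s t} → length x ≡ length y → x ++ s ≡ y ++ t → x ≡ y
++-cancel-prefix []      []      _ _  = refl
++-cancel-prefix (a ∷ x) (b ∷ y) e eq =
  cong₂ _∷_ (∷-injectiveˡ eq) (++-cancel-prefix x y (suc-injective e) (∷-injectiveʳ eq))

length-φ : ∀ w → length (φ w) ≡ length w + length w
length-φ w = trans (length-++ w) (cong (length w +_) (length-ψ w))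

#u-φ : ∀ w → #u (φ w) ≡ length w
#u-φ w = trans (#u-++ w (ψ w)) (trans (cong (#u w +_) (#u-ψ w)) (#u+#r≡length w))

ψ-φ : ∀ w → ψ (φ w) ≡ φ w
ψ-φ w = trans (ψ-++ w (ψ w)) (cong (_++ ψ w) (ψ-involutive w))

φ-zigzag : ∀ n → φ (zigzag n) ≡ zigzag (2 * n)
φ-zigzag n = begin
  zigzag n ++ ψ (zigzag n)  ≡⟨ cong (zigzag n ++_) (ψ-zigzag n) ⟩
  zigzag n ++ zigzag n      ≡⟨ zigzag-+ n n ⟨
  zigzag (n + n)            ≡⟨ cong zigzag (2*n≡n+n n) ⟨
  zigzag (2 * n)            ∎
  where open ≡-Reasoning

φ-mono : ∀ {x y} → x ⊑ y → φ x ⊑ φ y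
φ-mono h = BelowTo⇒Below (BelowTo-++ (proj₂ (Below⇒BelowTo h)) (ψ-BelowTo (proj₂ (Below⇒BelowTo h))))

φ-Sym : ∀ {n w} → DB n w → Sym (2 * n) (φ w)
φ-Sym {n} {w} db@(len , _) =
  (zigzag-⊑⇒DB (subst (_⊑ φ w) (φ-zigzag n) (φ-mono (DB⇒zigzag-⊑ {n} db))) , trans (#u-φ w) len) , ψ-φ w

φ-injective : ∀ {w w′} → length w ≡ length w′ → φ w ≡ φ w′ → w ≡ w′
φ-injective {w} {w′} = ++-cancel-prefix w w′

-- The first half t of a symmetric v = t ++ d satisfies ψ d ++ ψ t = t ++ d, so d = ψ t.
φ-surjective : ∀ {n v} → Sym (2 * n) v → ∃ λ w → DB n w × φ w ≡ v
φ-surjective {n} {v} (((len , pc) , _) , ψv≡v) = t , zigzag-⊑⇒DB zigzag⊑t , v≡φt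
  where
  L = 2 * n
  t = take L v
  d = drop L v
  length-v : length v ≡ L + L
  length-v = trans len (2*n≡n+n L)
  length-t : length t ≡ L
  length-t = trans (length-take L v) (trans (cong (L ⊓_) length-v) (m≤n⇒m⊓n≡m (m≤m+n L L)))
  length-d : length d ≡ L
  length-d = trans (length-drop L v) (trans (cong (_∸ L) length-v) (m+n∸m≡n L L))
  t++d≡v : t ++ d ≡ v
  t++d≡v = take++drop≡id L v
  ψd≡t : ψ d ≡ t
  ψd≡t = ++-cancel-prefix (ψ d) t (trans (length-ψ d) (trans length-d (sym length-t)))
    (trans (sym (ψ-++ t d)) (trans (cong ψ t++d≡v) (trans ψv≡v (sym t++d≡v))))
  v≡φt : φ t ≡ v
  v≡φt = trans (cong (t ++_) (trans (cong ψ (sym ψd≡t)) (ψ-involutive d))) t++d≡v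
  zigzag⊑t : zigzag n ⊑ t
  zigzag⊑t = Below-prefix (zigzag n) t (trans (length-zigzag n) (sym length-t))
    (subst₂ _⊑_ (sym (φ-zigzag n)) (sym t++d≡v) (DB⇒zigzag-⊑ {L} (len , pc)))

φ-≤D-iff : ∀ {w w′} → length w ≡ length w′ → w ≤D w′ ⇔ φ w ≤D φ w′
φ-≤D-iff {w} {w′} e =
  mk⇔ (λ h → ⊑⇒≤D {φ w} {φ w′} φ-length (φ-mono (≤D⇒⊑ {w} {w′} e h)))
      (λ h → ⊑⇒≤D {w} {w′} e (Below-prefix w w′ e (≤D⇒⊑ {φ w} {φ w′} φ-length h)))
  where
  φ-length : length (φ w) ≡ length (φ w′)
  φ-length = trans (length-φ w) (trans (cong₂ _+_ e e) (sym (length-φ w′)))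

theorem1p1 : ∀ (n : ℕ) → 0 < n →
    IsHeytingAlgebraOn (DB n) _≤D_ ×
    IsSublatticeOf (DA n) (DB n) _≤D_ ×
    IsHeytingAlgebraOn (DA n) _≤D_ ×
    ¬ IsHeytingSubalgebraOf (DA n) (DB n) _≤D_ ×
    (∀ w → DB n w → Sym (2 * n) (φ w)) ×
    (∀ w w′ → DB n w → DB n w′ → φ w ≡ φ w′ → w ≡ w′) ×
    (∀ v → Sym (2 * n) v → ∃ λ w → DB n w × φ w ≡ v) ×
    (∀ w w′ → DB n w → DB n w′ → (w ≤D w′ ⇔ φ w ≤D φ w′)) ×
    IsHeytingSubalgebraOf (Sym (2 * n)) (DA (2 * n)) _≤D_
theorem1p1 n n>0 =
  TypeB.isHeytingAlgebra n ,
  Unique.sublattice (DB n) _≤D_ (TypeB.antisym n) proj₁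
    (λ dx dy → _ , TypeA.∧-S n dx dy , TypeB.∧-isMeet n (proj₁ dx) (proj₁ dy))
    (λ dx dy → _ , TypeA.∨-S n dx dy , TypeB.∨-isJoin n (proj₁ dx) (proj₁ dy)) ,
  TypeA.isHeytingAlgebra n ,
  (λ (_ , _ , top-closed , _) → u^-not-DA n>0 (top-closed _ (TypeB.hi-isTop n))) ,
  (λ w → φ-Sym {n}) ,
  (λ w w′ d d′ → φ-injective {w} {w′} (TypeB.length-S₂ n d d′)) ,
  (λ v → φ-surjective {n}) ,
  (λ w w′ d d′ → φ-≤D-iff {w} {w′} (TypeB.length-S₂ n d d′)) ,
  SymmetricA.fixed-heytingSubalgebra (2 * n)
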